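{- Let $p,n$ be positive integers with $p\ge n\ge 5$ and $n-1\nmid p$. Then $$\frac{(n-2)p}2-\frac{(n-1)^2}8\le ex(p;T_n^2)\le \frac{(n-2)(p-1)}2.$$
   Context: All graphs are finite and simple. $ex(p;L)$ denotes the maximum number of edges of a graph on $p$ vertices containing no subgraph isomorphic to $L$. $T_n^2$ is the tree with vertex set $\{v_0,\ldots,v_{n-1}\}$ and edge set $\{v_0v_1,\ldots,v_0v_{n-3},v_{n-3}v_{n-2},v_{n-3}v_{n-1}\}$. -}

module Defs where

open import Data.Nat using (ℕ; zero; suc; _+_; _*_; _∸_; _≤_; _<_; _≡ᵇ_; _<ᵇ_)
open import Data.Bool using (Bool; true; false; _∧_; _∨_; not; if_then_else_)
open import Data.Bool.Properties using (∨-comm)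
open import Data.Fin using (Fin; toℕ)
open import Data.List using (List; map; allFin)
open import Data.Nat.ListAction using (sum)
open import Data.Product using (Σ; _×_; ∃; ∃-syntax)
open import Function.Definitions using (Injective)
open import Relation.Binary.PropositionalEquality using (_≡_; refl)
open import Relation.Nullary using (¬_)

record Graph (p : ℕ) : Set where
  field
    adj   : Fin p → Fin p → Bool
    sym   : ∀ i j → adj i j ≡ adj j i
    irref : ∀ i → adj i i ≡ false
open Graph public

edgeCount : ∀ {p} → Graph p → ℕ
edgeCount {p} G =
  sum (map (λ i → sum (map (λ j → if (toℕ i <ᵇ toℕ j) ∧ adj G i j then 1 else 0)
                           (allFin p)))
           (allFin p))

ContainsSubgraph : ∀ {p k} → Graph p → Graph k → Set
ContainsSubgraph {p} {k} G L =
  Σ (Fin k → Fin p) λ f →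
    Injective _≡_ _≡_ f × (∀ a b → adj L a b ≡ true → adj G (f a) (f b) ≡ true)

IsEx : (p : ℕ) → ∀ {k} → Graph k → ℕ → Set
IsEx p L m =
  (Σ (Graph p) λ G → ¬ ContainsSubgraph G L × edgeCount G ≡ m) ×
  (∀ (G : Graph p) → ¬ ContainsSubgraph G L → edgeCount G ≤ m)

-- The tree T_n^2 on v_0..v_{n-1}: edges v0v1,...,v0v_{n-3}, v_{n-3}v_{n-2}, v_{n-3}v_{n-1}.
-- tEdge n a b : a < b and {v_a, v_b} is an edge
tEdge : ℕ → ℕ → ℕ → Bool
tEdge n a b =
  ((a ≡ᵇ 0) ∧ (0 <ᵇ b) ∧ (b <ᵇ (n ∸ 2)))
  ∨ ((a ≡ᵇ (n ∸ 3)) ∧ ((b ≡ᵇ (n ∸ 2)) ∨ (b ≡ᵇ (n ∸ 1))))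

≡ᵇ-refl : ∀ m → (m ≡ᵇ m) ≡ true
≡ᵇ-refl zero = refl
≡ᵇ-refl (suc m) = ≡ᵇ-refl m

≡ᵇ-comm : ∀ m n → (m ≡ᵇ n) ≡ (n ≡ᵇ m)
≡ᵇ-comm zero zero = refl
≡ᵇ-comm zero (suc n) = refl
≡ᵇ-comm (suc m) zero = refl
≡ᵇ-comm (suc m) (suc n) = ≡ᵇ-comm m n

-- (the guard i ≠ j only matters for n < 3, where n - 3 = n - 2 in ℕ)
tAdj : (n : ℕ) → Fin n → Fin n → Bool
tAdj n i j = not (toℕ i ≡ᵇ toℕ j) ∧ (tEdge n (toℕ i) (toℕ j) ∨ tEdge n (toℕ j) (toℕ i))

T2 : (n : ℕ) → Graph n
T2 n = record { adj = tAdj n ; sym = s ; irref = r }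
  where
  s : ∀ i j → tAdj n i j ≡ tAdj n j i
  s i j rewrite ≡ᵇ-comm (toℕ i) (toℕ j) | ∨-comm (tEdge n (toℕ i) (toℕ j)) (tEdge n (toℕ j) (toℕ i)) = refl
  r : ∀ i → tAdj n i i ≡ false
  r i rewrite ≡ᵇ-refl (toℕ i) = refl

module Submission where

-- Write n = k + 5 and c = n − 2.  Both bounds are stated through degree
-- sums, which the handshake lemma relates to edgeCount.
--
-- In a T_n^2-free graph every vertex set U satisfies
--   Σ_{i ∈ U} deg_U(i) ≤ c ‖U‖,  and ≤ c ‖U‖ − c if c + 1 ∤ ‖U‖,
-- by induction on ‖U‖.  T-freeness enters only through the embedding
-- lemma: if x – y and y has two further neighbours a, b, then x has at most
-- k neighbours outside {y, a, b}.  If all degrees in G[U] are below c the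
-- bound is immediate; otherwise we remove the closed neighbourhood S of a
-- vertex x of largest degree.  The degree sum of U is that of U − S plus
-- the load of S, and the embedding lemma bounds the loads of the
-- neighbours of x in three cases: deg x > c; deg x = c with an edge
-- leaving S; deg x = c with no edge leaving the neighbours of x.
--
-- Cut {0, …, p − 1} into consecutive blocks of n − 1 vertices
-- and make each block a clique.  A copy of the connected tree T_n^2 would
-- lie in one block, which is too small.  With r = p mod (n − 1) this graph
-- has (c p + r² − (n − 1) r) / 2 edges, at least c p / 2 − (n − 1)² / 8.

open import Defs hiding (sym)
open import Data.Bool using (Bool; true; false; _∧_; _∨_; not; if_then_else_; T)
open import Data.Bool.Properties using (∨-zeroʳ; ∧-zeroʳ) renaming (_≟_ to _≟ᴮ_)
open import Data.Empty using (⊥; ⊥-elim)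
open import Data.Fin using (Fin; zero; suc; toℕ; fromℕ<)
open import Data.Fin.Properties using (_≟_; toℕ<n; toℕ-fromℕ<; toℕ-injective; any?; toℕ-inject₁; toℕ-fromℕ; pigeonhole)
  renaming (suc-injective to Fin-suc-injective)
open import Data.List using (map; allFin; tabulate)
open import Data.List.Properties using (map-tabulate)
open import Data.Nat using (ℕ; zero; suc; _+_; _*_; _∸_; _≤_; _<_; z≤n; s≤s; z<s; _≡ᵇ_; _<ᵇ_; _≤?_; _<?_)
open import Data.Nat.DivMod using (_/_; _%_; m≡m%n+[m/n]*n; [m+kn]%n≡m%n; m*n%n≡0; m%n<n; m<n⇒m%n≡m; m*n/n≡m; /-monoˡ-≤; m<n⇒m/n≡0; +-distrib-/)
open import Data.Nat.Tactic.RingSolver using (solve-∀)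
open import Data.Nat.Divisibility using (_∣_; _∣0; ∣-refl; ∣m∣n⇒∣m+n)
open import Data.Nat.ListAction using (sum)
open import Data.Nat.Properties hiding (_≟_)
open import Data.Product using (Σ; _×_; _,_; proj₁; proj₂)
open import Data.Sum using (_⊎_; inj₁; inj₂)
open import Data.Unit using (tt)
open import Function using (_∘_; id)
open import Relation.Binary.Definitions using (tri<; tri≈; tri>)
open import Relation.Binary.PropositionalEquality
open import Relation.Nullary using (¬_; does; yes; no)
open import Relation.Nullary.Decidable using (dec-true; dec-false; _×-dec_)
open import Algebra.Properties.CommutativeMonoid.Sum +-0-commutativeMonoid
  using (sum-syntax; ∑-distrib-+; ∑-comm; sum-cong-≗; sum-replicate-zero; sum-init-last)
open import Algebra.Properties.CommutativeSemigroup +-commutativeSemigroup using (x∙yz≈y∙xz; interchange)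

infixl 7 _·_
infixl 6 _∖_

_·_ : Bool → ℕ → ℕ
true  · n = n
false · n = 0

·-distrib-+ : ∀ b m n → b · (m + n) ≡ b · m + b · n
·-distrib-+ true  m n = refl
·-distrib-+ false m n = refl

·1≤1 : ∀ b → b · 1 ≤ 1
·1≤1 true  = ≤-refl
·1≤1 false = z≤n

·-distrib-∑ : ∀ {p} b (f : Fin p → ℕ) → b · (∑[ i < p ] f i) ≡ ∑[ i < p ] (b · f i)
·-distrib-∑     true  f = refl
·-distrib-∑ {p} false f = sym (sum-replicate-zero p)

∑-mono : ∀ {p} {f g : Fin p → ℕ} → (∀ i → f i ≤ g i) → ∑[ i < p ] f i ≤ ∑[ i < p ] g i
∑-mono {zero}  le = z≤n
∑-mono {suc p} le = +-mono-≤ (le zero) (∑-mono (le ∘ suc))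

∑-point : ∀ {p} (v : Fin p) (f : Fin p → ℕ) → ∑[ i < p ] (does (i ≟ v) · f i) ≡ f v
∑-point {suc p} zero    f = trans (cong (f zero +_) (sum-replicate-zero p)) (+-identityʳ (f zero))
∑-point {suc p} (suc v) f = ∑-point v (f ∘ suc)

Subset : ℕ → Set
Subset p = Fin p → Bool

_⊆_ : ∀ {p} → Subset p → Subset p → Set
P ⊆ Q = ∀ i → P i ≡ true → Q i ≡ true

‖_‖ : ∀ {p} → Subset p → ℕ
‖_‖ {p} P = ∑[ i < p ] (P i · 1)

∑-bound : ∀ {p} (P : Subset p) (f : Fin p → ℕ) B → (∀ i → P i ≡ true → f i ≤ B) →
  ∑[ i < p ] (P i · f i) ≤ B * ‖ P ‖
∑-bound {zero}  P f B le = z≤n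
∑-bound {suc p} P f B le with P zero in Pz
... | true  = subst (f zero + ∑[ i < p ] (P (suc i) · f (suc i)) ≤_) (sym (*-suc B ‖ P ∘ suc ‖))
                (+-mono-≤ (le zero Pz) (∑-bound (P ∘ suc) (f ∘ suc) B (le ∘ suc)))
... | false = ∑-bound (P ∘ suc) (f ∘ suc) B (le ∘ suc)

‖‖-mono : ∀ {p} {P Q : Subset p} → P ⊆ Q → ‖ P ‖ ≤ ‖ Q ‖
‖‖-mono {P = P} {Q} P⊆Q = ∑-mono pointwise
  where
  pointwise : ∀ i → P i · 1 ≤ Q i · 1
  pointwise i with P i in Pi
  ... | false = z≤n
  ... | true  rewrite P⊆Q i Pi = ≤-refl

‖‖-empty : ∀ {p} (P : Subset p) → (∀ i → P i ≡ false) → ‖ P ‖ ≡ 0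
‖‖-empty {p} P none = trans (sum-cong-≗ (λ i → cong (_· 1) (none i))) (sum-replicate-zero p)

‖‖-full : ∀ p → ‖ (λ (_ : Fin p) → true) ‖ ≡ p
‖‖-full zero    = refl
‖‖-full (suc p) = cong suc (‖‖-full p)

_∖_ : ∀ {p} → Subset p → Fin p → Subset p
(P ∖ v) j = P j ∧ not (does (j ≟ v))

∖-intro : ∀ {p} (P : Subset p) {v j} → P j ≡ true → j ≢ v → (P ∖ v) j ≡ true
∖-intro P {v} {j} Pj j≢v rewrite Pj | dec-false (j ≟ v) j≢v = refl

∖-elim : ∀ {p} (P : Subset p) {v j} → (P ∖ v) j ≡ true → P j ≡ true × j ≢ v
∖-elim P {v} {j} Pj∖v with P j | j ≟ v
... | true | no j≢v = refl , j≢v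

∖∖∖-elim : ∀ {p} (P : Subset p) {a b d v} → (P ∖ a ∖ b ∖ d) v ≡ true →
  P v ≡ true × v ≢ a × v ≢ b × v ≢ d
∖∖∖-elim P {a} {b} {d} e =
  let v∈P∖a∖b , v≢d = ∖-elim (P ∖ a ∖ b) e
      v∈P∖a   , v≢b = ∖-elim (P ∖ a) v∈P∖a∖b
      v∈P     , v≢a = ∖-elim P v∈P∖a
  in v∈P , v≢a , v≢b , v≢d

‖∖‖ : ∀ {p} (P : Subset p) v → ‖ P ‖ ≡ ‖ P ∖ v ‖ + P v · 1
‖∖‖ {p} P v = begin
  ‖ P ‖                                                ≡⟨ sum-cong-≗ split ⟩
  ∑[ i < p ] ((P ∖ v) i · 1 + does (i ≟ v) · (P i · 1)) ≡⟨ ∑-distrib-+ (λ i → (P ∖ v) i · 1) (λ i → does (i ≟ v) · (P i · 1)) ⟩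
  ‖ P ∖ v ‖ + ∑[ i < p ] (does (i ≟ v) · (P i · 1))     ≡⟨ cong (‖ P ∖ v ‖ +_) (∑-point v (λ i → P i · 1)) ⟩
  ‖ P ∖ v ‖ + P v · 1                                  ∎
  where
  open ≡-Reasoning
  split : ∀ i → P i · 1 ≡ (P ∖ v) i · 1 + does (i ≟ v) · (P i · 1)
  split i with P i | does (i ≟ v)
  ... | true  | true  = refl
  ... | true  | false = refl
  ... | false | true  = refl
  ... | false | false = refl

‖∖‖-≤ : ∀ {p} (P : Subset p) v → ‖ P ‖ ≤ ‖ P ∖ v ‖ + 1
‖∖‖-≤ P v = subst (_≤ ‖ P ∖ v ‖ + 1) (sym (‖∖‖ P v)) (+-monoʳ-≤ ‖ P ∖ v ‖ (·1≤1 (P v)))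

‖∖‖-∈ : ∀ {p} (P : Subset p) v → P v ≡ true → ‖ P ‖ ≡ ‖ P ∖ v ‖ + 1
‖∖‖-∈ P v Pv = trans (‖∖‖ P v) (cong (λ b → ‖ P ∖ v ‖ + b · 1) Pv)

‖∖‖-∉ : ∀ {p} (P : Subset p) v → P v ≡ false → ‖ P ∖ v ‖ ≡ ‖ P ‖
‖∖‖-∉ P v Pv = sym (trans (‖∖‖ P v) (trans (cong (λ b → ‖ P ∖ v ‖ + b · 1) Pv) (+-identityʳ _)))

‖∖‖-lower : ∀ {p} (P : Subset p) v {t} → suc t ≤ ‖ P ‖ → t ≤ ‖ P ∖ v ‖
‖∖‖-lower P v {t} le =
  +-cancelʳ-≤ 1 t ‖ P ∖ v ‖ (subst (_≤ ‖ P ∖ v ‖ + 1) (+-comm 1 t) (≤-trans le (‖∖‖-≤ P v)))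

‖‖-pos : ∀ {p} (P : Subset p) v → P v ≡ true → 1 ≤ ‖ P ‖
‖‖-pos P v Pv = subst (1 ≤_) (sym (‖∖‖-∈ P v Pv)) (m≤n+m 1 ‖ P ∖ v ‖)

‖‖-three : ∀ {p} (P : Subset p) {a b d} → P a ≡ true → P b ≡ true → P d ≡ true →
  a ≢ b → a ≢ d → b ≢ d → 3 ≤ ‖ P ‖
‖‖-three P {a} {b} {d} Pa Pb Pd a≢b a≢d b≢d = begin
  3                     ≤⟨ +-monoˡ-≤ 2 (‖‖-pos (P ∖ a ∖ b) d (∖-intro (P ∖ a) (∖-intro P Pd (a≢d ∘ sym)) (b≢d ∘ sym))) ⟩
  ‖ P ∖ a ∖ b ‖ + 2     ≡⟨ +-assoc ‖ P ∖ a ∖ b ‖ 1 1 ⟨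
  ‖ P ∖ a ∖ b ‖ + 1 + 1 ≡⟨ cong (_+ 1) (‖∖‖-∈ (P ∖ a) b (∖-intro P Pb (a≢b ∘ sym))) ⟨
  ‖ P ∖ a ‖ + 1         ≡⟨ ‖∖‖-∈ P a Pa ⟨
  ‖ P ‖                 ∎
  where open ≤-Reasoning

‖‖-remove-three : ∀ {p} (P : Subset p) a b d → ‖ P ‖ ≤ ‖ P ∖ a ∖ b ∖ d ‖ + 3
‖‖-remove-three P a b d = begin
  ‖ P ‖                         ≤⟨ ‖∖‖-≤ P a ⟩
  ‖ P ∖ a ‖ + 1                 ≤⟨ +-monoˡ-≤ 1 (‖∖‖-≤ (P ∖ a) b) ⟩
  ‖ P ∖ a ∖ b ‖ + 1 + 1         ≤⟨ +-monoˡ-≤ 1 (+-monoˡ-≤ 1 (‖∖‖-≤ (P ∖ a ∖ b) d)) ⟩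
  ‖ P ∖ a ∖ b ∖ d ‖ + 1 + 1 + 1 ≡⟨ +-assoc (‖ P ∖ a ∖ b ∖ d ‖ + 1) 1 1 ⟩
  ‖ P ∖ a ∖ b ∖ d ‖ + 1 + 2     ≡⟨ +-assoc ‖ P ∖ a ∖ b ∖ d ‖ 1 2 ⟩
  ‖ P ∖ a ∖ b ∖ d ‖ + 3         ∎
  where open ≤-Reasoning

_−_ : ∀ {p} → Subset p → Subset p → Subset p
(U − S) i = U i ∧ not (S i)

∑-split : ∀ {p} {U S : Subset p} → S ⊆ U → ∀ (f : Fin p → ℕ) →
  ∑[ i < p ] (U i · f i) ≡ ∑[ i < p ] (S i · f i) + ∑[ i < p ] ((U − S) i · f i)
∑-split {p} {U} {S} S⊆U f =
  trans (sum-cong-≗ pointwise) (∑-distrib-+ (λ i → S i · f i) (λ i → (U − S) i · f i))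
  where
  pointwise : ∀ i → U i · f i ≡ S i · f i + (U − S) i · f i
  pointwise i with S i in Si
  ... | true  rewrite S⊆U i Si = sym (+-identityʳ (f i))
  ... | false with U i
  ...   | true  = refl
  ...   | false = refl

‖−‖ : ∀ {p} {U S : Subset p} → S ⊆ U → ‖ U ‖ ≡ ‖ U − S ‖ + ‖ S ‖
‖−‖ {U = U} {S} S⊆U = trans (∑-split S⊆U (λ _ → 1)) (+-comm ‖ S ‖ ‖ U − S ‖)

insert : ∀ {p} → Fin p → Subset p → Subset p
insert x P j = does (j ≟ x) ∨ P j

∑-insert : ∀ {p} x (P : Subset p) → P x ≡ false → ∀ (f : Fin p → ℕ) →
  ∑[ i < p ] (insert x P i · f i) ≡ f x + ∑[ i < p ] (P i · f i)
∑-insert {p} x P Px f = begin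
  ∑[ i < p ] (insert x P i · f i)                          ≡⟨ sum-cong-≗ pointwise ⟩
  ∑[ i < p ] (does (i ≟ x) · f i + P i · f i)              ≡⟨ ∑-distrib-+ (λ i → does (i ≟ x) · f i) (λ i → P i · f i) ⟩
  ∑[ i < p ] (does (i ≟ x) · f i) + ∑[ i < p ] (P i · f i) ≡⟨ cong (_+ ∑[ i < p ] (P i · f i)) (∑-point x f) ⟩
  f x + ∑[ i < p ] (P i · f i)                             ∎
  where
  open ≡-Reasoning
  pointwise : ∀ i → insert x P i · f i ≡ does (i ≟ x) · f i + P i · f i
  pointwise i with i ≟ x
  ... | yes refl rewrite Px = sym (+-identityʳ (f i))
  ... | no  _    = refl

choose : ∀ {p} (P : Subset p) t → t ≤ ‖ P ‖ →
  Σ (Fin t → Fin p) λ W → (∀ i j → W i ≡ W j → i ≡ j) × (∀ i → P (W i) ≡ true)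
choose {p} P zero le = (λ ()) , (λ ()) , (λ ())
choose {suc p} P (suc t) le with P zero in Pz
... | false with choose (P ∘ suc) (suc t) le
...   | W , W-inj , W∈P = suc ∘ W , (λ i j e → W-inj i j (Fin-suc-injective e)) , W∈P
choose {suc p} P (suc t) le | true with choose (P ∘ suc) t (≤-pred le)
...   | W , W-inj , W∈P = extend , extend-inj , extend-∈P
  where
  extend : Fin (suc t) → Fin (suc p)
  extend zero    = zero
  extend (suc i) = suc (W i)
  extend-inj : ∀ i j → extend i ≡ extend j → i ≡ j
  extend-inj zero    zero    e = refl
  extend-inj (suc i) (suc j) e = cong suc (W-inj i j (Fin-suc-injective e))
  extend-∈P : ∀ i → P (extend i) ≡ true
  extend-∈P zero    = Pz
  extend-∈P (suc i) = W∈P i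

choose-one : ∀ {p} (P : Subset p) → 1 ≤ ‖ P ‖ → Σ (Fin p) λ a → P a ≡ true
choose-one P le with choose P 1 le
... | W , _ , ∈P = W zero , ∈P zero

choose-two : ∀ {p} (P : Subset p) → 2 ≤ ‖ P ‖ →
  Σ (Fin p) λ a → Σ (Fin p) λ b → a ≢ b × P a ≡ true × P b ≡ true
choose-two P le with choose P 2 le
... | W , inj , ∈P = W zero , W (suc zero) , (λ e → 0≢1 (inj zero (suc zero) e)) , ∈P zero , ∈P (suc zero)
  where
  0≢1 : zero ≢ suc zero
  0≢1 ()

true≢false : true ≢ false
true≢false ()

T⇒true : ∀ {b} → T b → b ≡ true
T⇒true {true} _ = refl

∧-true : ∀ a b → a ∧ b ≡ true → a ≡ true × b ≡ true
∧-true true true _ = refl , refl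

not-true : ∀ b → not b ≡ true → b ≡ false
not-true false _ = refl

∨-false : ∀ a b → a ∨ b ≡ false → b ≡ false
∨-false false b e = e

∨-true : ∀ a b → a ∨ b ≡ true → a ≡ true ⊎ b ≡ true
∨-true true  b _ = inj₁ refl
∨-true false b e = inj₂ e

≡ᵇ-sound : ∀ m n → (m ≡ᵇ n) ≡ true → m ≡ n
≡ᵇ-sound m n e = ≡ᵇ⇒≡ m n (subst T (sym e) tt)

≡ᵇ-false : ∀ m n → m ≢ n → (m ≡ᵇ n) ≡ false
≡ᵇ-false m n m≢n with m ≡ᵇ n in e
... | true  = ⊥-elim (m≢n (≡ᵇ-sound m n e))
... | false = refl

<ᵇ-sound : ∀ m n → (m <ᵇ n) ≡ true → m < n
<ᵇ-sound m n e = <ᵇ⇒< m n (subst T (sym e) tt)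

<ᵇ-true : ∀ {m n} → m < n → (m <ᵇ n) ≡ true
<ᵇ-true lt = T⇒true (<⇒<ᵇ lt)

<ᵇ-false : ∀ m n → n ≤ m → (m <ᵇ n) ≡ false
<ᵇ-false m n n≤m with m <ᵇ n in e
... | true  = ⊥-elim (≤⇒≯ n≤m (<ᵇ-sound m n e))
... | false = refl

sum-tabulate : ∀ {p} (f : Fin p → ℕ) → sum (tabulate f) ≡ ∑[ i < p ] f i
sum-tabulate {zero}  f = refl
sum-tabulate {suc p} f = cong (f zero +_) (sum-tabulate (f ∘ suc))

sum-allFin : ∀ p (f : Fin p → ℕ) → sum (map f (allFin p)) ≡ ∑[ i < p ] f i
sum-allFin p f = trans (cong sum (map-tabulate id f)) (sum-tabulate f)

handshake : ∀ {p} (G : Graph p) → 2 * edgeCount G ≡ ∑[ i < p ] ‖ adj G i ‖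
handshake {p} G = begin
  2 * edgeCount G                                         ≡⟨ cong (2 *_) counted ⟩
  2 * E                                                   ≡⟨ cong (E +_) (+-identityʳ E) ⟩
  E + E                                                   ≡⟨ cong (E +_) (∑-comm up) ⟩
  E + ∑[ i < p ] ∑[ j < p ] up j i                        ≡⟨ ∑-distrib-+ (λ i → ∑[ j < p ] up i j) (λ i → ∑[ j < p ] up j i) ⟨
  ∑[ i < p ] (∑[ j < p ] up i j + ∑[ j < p ] up j i)      ≡⟨ sum-cong-≗ (λ i → ∑-distrib-+ (up i) (λ j → up j i)) ⟨
  ∑[ i < p ] ∑[ j < p ] (up i j + up j i)                 ≡⟨ sum-cong-≗ (λ i → sum-cong-≗ (λ j → both-orders i j)) ⟨
  ∑[ i < p ] ‖ adj G i ‖                                  ∎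
  where
  open ≡-Reasoning
  up : Fin p → Fin p → ℕ
  up i j = ((toℕ i <ᵇ toℕ j) ∧ adj G i j) · 1
  E : ℕ
  E = ∑[ i < p ] ∑[ j < p ] up i j
  if-as-· : ∀ b → (if b then 1 else 0) ≡ b · 1
  if-as-· true  = refl
  if-as-· false = refl
  counted : edgeCount G ≡ E
  counted = trans (sum-allFin p _)
    (sum-cong-≗ (λ i → trans (sum-allFin p _) (sum-cong-≗ (λ j → if-as-· ((toℕ i <ᵇ toℕ j) ∧ adj G i j)))))
  both-orders : ∀ i j → adj G i j · 1 ≡ up i j + up j i
  both-orders i j with <-cmp (toℕ i) (toℕ j)
  ... | tri< lt _ _ rewrite <ᵇ-true lt | <ᵇ-false (toℕ j) (toℕ i) (<⇒≤ lt) = sym (+-identityʳ _)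
  ... | tri> _ _ gt rewrite <ᵇ-true gt | <ᵇ-false (toℕ i) (toℕ j) (<⇒≤ gt) = cong (_· 1) (Graph.sym G i j)
  ... | tri≈ _ eq _ rewrite toℕ-injective {i = i} {j = j} eq | irref G j | <ᵇ-false (toℕ j) (toℕ j) ≤-refl = refl

Connected : ∀ {q} → Graph (suc q) → Set
Connected {q} L = ∀ (φ : Fin (suc q) → ℕ) → (∀ i j → adj L i j ≡ true → φ i ≡ φ j) → ∀ v → φ v ≡ φ zero

module Tree (k : ℕ) where

  n : ℕ
  n = 5 + k

  data Edge (a b : ℕ) : Set where
    spoke : a ≡ 0 → 0 < b → b < 3 + k → Edge a b
    fork  : a ≡ 2 + k → b ≡ 3 + k ⊎ b ≡ 4 + k → Edge a b

  twig-index : ∀ {b} → b ≡ 3 + k ⊎ b ≡ 4 + k → 2 + k < b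
  twig-index (inj₁ refl) = n<1+n (2 + k)
  twig-index (inj₂ refl) = m<n⇒m<1+n (n<1+n (2 + k))

  Edge⇒< : ∀ {a b} → Edge a b → a < b
  Edge⇒< (spoke refl 0<b _) = 0<b
  Edge⇒< (fork refl twig)   = twig-index twig

  tEdge⇒Edge : ∀ a b → tEdge n a b ≡ true → Edge a b
  tEdge⇒Edge a b e with ∨-true _ _ e
  ... | inj₁ s = let a≡0 , bounds = ∧-true (a ≡ᵇ 0) _ s
                     0<b , b<    = ∧-true (0 <ᵇ b) _ bounds
                 in spoke (≡ᵇ-sound a 0 a≡0) (<ᵇ-sound 0 b 0<b) (<ᵇ-sound b (3 + k) b<)
  ... | inj₂ f = let a≡c , twig = ∧-true (a ≡ᵇ (2 + k)) _ f
                 in fork (≡ᵇ-sound a (2 + k) a≡c) (twig-cases (∨-true _ _ twig))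
    where
    twig-cases : (b ≡ᵇ (3 + k)) ≡ true ⊎ (b ≡ᵇ (4 + k)) ≡ true → b ≡ 3 + k ⊎ b ≡ 4 + k
    twig-cases (inj₁ e) = inj₁ (≡ᵇ-sound b (3 + k) e)
    twig-cases (inj₂ e) = inj₂ (≡ᵇ-sound b (4 + k) e)

  Edge⇒tEdge : ∀ {a b} → Edge a b → tEdge n a b ≡ true
  Edge⇒tEdge (spoke refl 0<b b<) rewrite <ᵇ-true 0<b | <ᵇ-true b< = refl
  Edge⇒tEdge (fork refl (inj₁ refl)) rewrite ≡ᵇ-refl k = refl
  Edge⇒tEdge (fork refl (inj₂ refl)) rewrite ≡ᵇ-refl k | ∨-zeroʳ (suc k ≡ᵇ k) = refl

  T-edge : ∀ i j → adj (T2 n) i j ≡ true → Edge (toℕ i) (toℕ j) ⊎ Edge (toℕ j) (toℕ i)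
  T-edge i j e with ∨-true _ _ (proj₂ (∧-true (not (toℕ i ≡ᵇ toℕ j)) _ e))
  ... | inj₁ ij = inj₁ (tEdge⇒Edge (toℕ i) (toℕ j) ij)
  ... | inj₂ ji = inj₂ (tEdge⇒Edge (toℕ j) (toℕ i) ji)

  T-adj : ∀ i j → Edge (toℕ i) (toℕ j) → adj (T2 n) i j ≡ true
  T-adj i j e rewrite ≡ᵇ-false (toℕ i) (toℕ j) (<⇒≢ (Edge⇒< e)) | Edge⇒tEdge e = refl

  data Role : ℕ → Set where
    root   : Role 0
    leaf   : (i : Fin (suc k)) → Role (suc (toℕ i))
    centre : Role (2 + k)
    twigA  : Role (3 + k)
    twigB  : Role (4 + k)

  role : ∀ v → v < n → Role v
  role zero    _          = root
  role (suc v) (s≤s v<) with v <? suc k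
  ... | yes v<1+k = subst (Role ∘ suc) (toℕ-fromℕ< v<1+k) (leaf (fromℕ< v<1+k))
  ... | no  v≮1+k = beyond-leaves (v ∸ suc k) (m∸n+n≡m (≮⇒≥ v≮1+k)) v<
    where
    beyond-leaves : ∀ d {v} → d + suc k ≡ v → v < 4 + k → Role (suc v)
    beyond-leaves 0 refl _ = centre
    beyond-leaves 1 refl _ = twigA
    beyond-leaves 2 refl _ = twigB
    beyond-leaves (suc (suc (suc d))) refl (s≤s (s≤s (s≤s (s≤s lt)))) =
      ⊥-elim (<-irrefl refl (≤-trans (m≤n+m (suc k) d) lt))

  roleOf : (v : Fin n) → Role (toℕ v)
  roleOf v = role (toℕ v) (toℕ<n v)

  centreVertex : Fin n
  centreVertex = fromℕ< {2 + k} (s≤s (s≤s (s≤s (m≤n⇒m≤1+n (n≤1+n k)))))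

  centreVertex-index : toℕ centreVertex ≡ 2 + k
  centreVertex-index = toℕ-fromℕ< (s≤s (s≤s (s≤s (m≤n⇒m≤1+n (n≤1+n k)))))

  -- T_n^2 is connected: every vertex is joined to the root directly or
  -- through the centre.
  T-connected : Connected (T2 n)
  T-connected φ along v = via (roleOf v) refl
    where
    from-root : ∀ w → Edge 0 (toℕ w) → φ w ≡ φ zero
    from-root w e = sym (along zero w (T-adj zero w e))
    centre-to-root : φ centreVertex ≡ φ zero
    centre-to-root = from-root centreVertex (subst (Edge 0) (sym centreVertex-index) (spoke refl z<s (n<1+n _)))
    from-centre : ∀ {t} → toℕ v ≡ t → t ≡ 3 + k ⊎ t ≡ 4 + k → φ v ≡ φ zero
    from-centre e twig = trans (sym (along centreVertex v (T-adj centreVertex v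
      (subst₂ Edge (sym centreVertex-index) (sym e) (fork refl twig))))) centre-to-root
    via : ∀ {t} → Role t → toℕ v ≡ t → φ v ≡ φ zero
    via root     e = cong φ (toℕ-injective e)
    via (leaf i) e = from-root v (subst (Edge 0) (sym e) (spoke refl z<s (s≤s (m≤n⇒m≤1+n (toℕ<n i)))))
    via centre   e = from-root v (subst (Edge 0) (sym e) (spoke refl z<s (n<1+n _)))
    via twigA    e = from-centre e (inj₁ refl)
    via twigB    e = from-centre e (inj₂ refl)

module Embedding (k : ℕ) {p : ℕ} (G : Graph p) where
  open Tree k

  adj⇒≢ : ∀ {u v} → adj G u v ≡ true → u ≢ v
  adj⇒≢ {u} uv refl = true≢false (trans (sym uv) (irref G u))

  -- Sending the root to x, the leaves to the k + 1 distinct private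
  -- neighbours W of x, the centre to y and the twigs to a and b embeds T.
  module Copy (x y a b : Fin p) (W : Fin (suc k) → Fin p)
    (xy : adj G x y ≡ true) (ya : adj G y a ≡ true) (yb : adj G y b ≡ true)
    (a≢b : a ≢ b) (a≢x : a ≢ x) (b≢x : b ≢ x)
    (W-inj : ∀ i j → W i ≡ W j → i ≡ j) (W-private : ∀ i → (adj G x ∖ y ∖ a ∖ b) (W i) ≡ true) where

    xW : ∀ i → adj G x (W i) ≡ true
    xW i = proj₁ (∖∖∖-elim (adj G x) (W-private i))

    W≢y : ∀ i → W i ≢ y
    W≢y i = proj₁ (proj₂ (∖∖∖-elim (adj G x) (W-private i)))

    W≢a : ∀ i → W i ≢ a
    W≢a i = proj₁ (proj₂ (proj₂ (∖∖∖-elim (adj G x) (W-private i))))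

    W≢b : ∀ i → W i ≢ b
    W≢b i = proj₂ (proj₂ (proj₂ (∖∖∖-elim (adj G x) (W-private i))))

    image : ∀ {v} → Role v → Fin p
    image root     = x
    image (leaf i) = W i
    image centre   = y
    image twigA    = a
    image twigB    = b

    image-edge : ∀ {u v} (Ru : Role u) (Rv : Role v) → Edge u v → adj G (image Ru) (image Rv) ≡ true
    image-edge root     root     (spoke _ () _)
    image-edge root     (leaf i) (spoke _ _ _)  = xW i
    image-edge root     centre   (spoke _ _ _)  = xy
    image-edge root     twigA    (spoke _ _ lt) = ⊥-elim (<-irrefl refl lt)
    image-edge root     twigB    (spoke _ _ lt) = ⊥-elim (<-asym lt (n<1+n (3 + k)))
    image-edge root     _        (fork () _)
    image-edge (leaf i) _        (spoke () _ _)
    image-edge (leaf i) _        (fork e _)     = ⊥-elim (<-irrefl (suc-injective e) (toℕ<n i))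
    image-edge centre   _        (spoke () _ _)
    image-edge centre   root     (fork _ twig)  = ⊥-elim (<-asym (twig-index twig) z<s)
    image-edge centre   (leaf j) (fork _ twig)  = ⊥-elim (<-asym (twig-index twig) (s≤s (toℕ<n j)))
    image-edge centre   centre   (fork _ twig)  = ⊥-elim (<-irrefl refl (twig-index twig))
    image-edge centre   twigA    (fork _ _)     = ya
    image-edge centre   twigB    (fork _ _)     = yb
    image-edge twigA    _        (spoke () _ _)
    image-edge twigA    _        (fork e _)     = ⊥-elim (1+n≢n e)
    image-edge twigB    _        (spoke () _ _)
    image-edge twigB    _        (fork e _)     = ⊥-elim (m+1+n≢n 1 e)

    image-injective : ∀ {u v} (Ru : Role u) (Rv : Role v) → image Ru ≡ image Rv → u ≡ v
    image-injective root     root     e = refl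
    image-injective root     (leaf i) e = ⊥-elim (adj⇒≢ (xW i) e)
    image-injective root     centre   e = ⊥-elim (adj⇒≢ xy e)
    image-injective root     twigA    e = ⊥-elim (a≢x (sym e))
    image-injective root     twigB    e = ⊥-elim (b≢x (sym e))
    image-injective (leaf i) root     e = ⊥-elim (adj⇒≢ (xW i) (sym e))
    image-injective (leaf i) (leaf j) e = cong (suc ∘ toℕ) (W-inj i j e)
    image-injective (leaf i) centre   e = ⊥-elim (W≢y i e)
    image-injective (leaf i) twigA    e = ⊥-elim (W≢a i e)
    image-injective (leaf i) twigB    e = ⊥-elim (W≢b i e)
    image-injective centre   root     e = ⊥-elim (adj⇒≢ xy (sym e))
    image-injective centre   (leaf i) e = ⊥-elim (W≢y i (sym e))
    image-injective centre   centre   e = refl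
    image-injective centre   twigA    e = ⊥-elim (adj⇒≢ ya e)
    image-injective centre   twigB    e = ⊥-elim (adj⇒≢ yb e)
    image-injective twigA    root     e = ⊥-elim (a≢x e)
    image-injective twigA    (leaf i) e = ⊥-elim (W≢a i (sym e))
    image-injective twigA    centre   e = ⊥-elim (adj⇒≢ ya (sym e))
    image-injective twigA    twigA    e = refl
    image-injective twigA    twigB    e = ⊥-elim (a≢b e)
    image-injective twigB    root     e = ⊥-elim (b≢x e)
    image-injective twigB    (leaf i) e = ⊥-elim (W≢b i (sym e))
    image-injective twigB    centre   e = ⊥-elim (adj⇒≢ yb (sym e))
    image-injective twigB    twigA    e = ⊥-elim (a≢b (sym e))
    image-injective twigB    twigB    e = refl

    f : Fin n → Fin p
    f v = image (roleOf v)

    copy : ContainsSubgraph G (T2 n)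
    copy = f , (λ {i} {j} e → toℕ-injective (image-injective (roleOf i) (roleOf j) e)) , edges
      where
      edges : ∀ i j → adj (T2 n) i j ≡ true → adj G (f i) (f j) ≡ true
      edges i j e with T-edge i j e
      ... | inj₁ ij = image-edge (roleOf i) (roleOf j) ij
      ... | inj₂ ji = trans (Graph.sym G (f i) (f j)) (image-edge (roleOf j) (roleOf i) ji)

  few-private-neighbours : ¬ ContainsSubgraph G (T2 n) →
    ∀ {x y a b} → adj G x y ≡ true → adj G y a ≡ true → adj G y b ≡ true →
    a ≢ b → a ≢ x → b ≢ x → ‖ adj G x ∖ y ∖ a ∖ b ‖ ≤ k
  few-private-neighbours free {x} {y} {a} {b} xy ya yb a≢b a≢x b≢x
    with ‖ adj G x ∖ y ∖ a ∖ b ‖ ≤? k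
  ... | yes few  = few
  ... | no  many with choose (adj G x ∖ y ∖ a ∖ b) (suc k) (≰⇒> many)
  ...   | W , W-inj , W-private = ⊥-elim (free (Copy.copy x y a b W xy ya yb a≢b a≢x b≢x W-inj W-private))

star-arith : ∀ {B c} D → B < c → D + B * D + c ≤ c * suc D
star-arith {B} {c} D B<c = begin
  D + B * D + c ≡⟨ +-comm (D + B * D) c ⟩
  c + suc B * D ≤⟨ +-monoʳ-≤ c (*-monoˡ-≤ D B<c) ⟩
  c + c * D     ≡⟨ *-suc c D ⟨
  c * suc D     ∎
  where open ≤-Reasoning

closed-arith : ∀ {c D} → D ≤ c → D + c * D ≤ c * suc D
closed-arith {c} {D} D≤c = ≤-trans (+-monoˡ-≤ (c * D) D≤c) (≤-reflexive (sym (*-suc c D)))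

small-arith : ∀ {s c} → suc s ≤ c → s * suc s + c ≤ c * suc s
small-arith {s} {c} s<c = begin
  s * suc s + c ≡⟨ +-comm (s * suc s) c ⟩
  c + s * suc s ≡⟨ cong (c +_) (*-comm s (suc s)) ⟩
  c + suc s * s ≤⟨ +-monoʳ-≤ c (*-monoˡ-≤ s s<c) ⟩
  c + c * s     ≡⟨ *-suc c s ⟨
  c * suc s     ∎
  where open ≤-Reasoning

module UpperBound (k : ℕ) {p : ℕ} (G : Graph p) (free : ¬ ContainsSubgraph G (T2 (5 + k))) where
  open Embedding k G using (adj⇒≢; few-private-neighbours)

  c : ℕ
  c = 3 + k

  adj-sym : ∀ {i j} → adj G i j ≡ true → adj G j i ≡ true
  adj-sym {i} {j} e = trans (Graph.sym G j i) e

  degree-bound : ∀ {x y a b} → adj G x y ≡ true → adj G y a ≡ true → adj G y b ≡ true →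
    a ≢ b → a ≢ x → b ≢ x → ‖ adj G x ‖ ≤ c
  degree-bound {x} {y} {a} {b} xy ya yb a≢b a≢x b≢x = begin
    ‖ adj G x ‖                 ≤⟨ ‖‖-remove-three (adj G x) y a b ⟩
    ‖ adj G x ∖ y ∖ a ∖ b ‖ + 3 ≤⟨ +-monoˡ-≤ 3 (few-private-neighbours free xy ya yb a≢b a≢x b≢x) ⟩
    k + 3                       ≡⟨ +-comm k 3 ⟩
    c                           ∎
    where open ≤-Reasoning

  _∩N_ : Subset p → Fin p → Subset p
  (U ∩N i) j = U j ∧ adj G i j

  deg : Subset p → Fin p → ℕ
  deg U i = ‖ U ∩N i ‖

  ∩N-elim : ∀ U i j → (U ∩N i) j ≡ true → U j ≡ true × adj G i j ≡ true
  ∩N-elim U i j = ∧-true (U j) (adj G i j)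

  deg≤ : ∀ U i → deg U i ≤ ‖ adj G i ‖
  deg≤ U i = ‖‖-mono (λ j e → proj₂ (∩N-elim U i j e))

  degSum : Subset p → ℕ
  degSum U = ∑[ i < p ] (U i · deg U i)

  Bounded : Subset p → Set
  Bounded U = (degSum U ≤ c * ‖ U ‖) × (¬ (suc c ∣ ‖ U ‖) → degSum U + c ≤ c * ‖ U ‖)

  Bounded-strong : ∀ {U} → degSum U + c ≤ c * ‖ U ‖ → Bounded U
  Bounded-strong {U} strong = ≤-trans (m≤m+n (degSum U) c) strong , λ _ → strong

  edges-between : ∀ (P Q : Subset p) → ∑[ i < p ] (P i · deg Q i) ≡ ∑[ j < p ] (Q j · deg P j)
  edges-between P Q = begin
    ∑[ i < p ] (P i · deg Q i)                               ≡⟨ sum-cong-≗ (λ i → ·-distrib-∑ (P i) (λ j → (Q ∩N i) j · 1)) ⟩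
    ∑[ i < p ] ∑[ j < p ] (P i · ((Q ∩N i) j · 1))           ≡⟨ ∑-comm (λ i j → P i · ((Q ∩N i) j · 1)) ⟩
    ∑[ j < p ] ∑[ i < p ] (P i · ((Q ∩N i) j · 1))           ≡⟨ sum-cong-≗ (λ j → sum-cong-≗ (λ i → swap i j)) ⟩
    ∑[ j < p ] ∑[ i < p ] (Q j · ((P ∩N j) i · 1))           ≡⟨ sum-cong-≗ (λ j → ·-distrib-∑ (Q j) (λ i → (P ∩N j) i · 1)) ⟨
    ∑[ j < p ] (Q j · deg P j)                               ∎
    where
    open ≡-Reasoning
    swap : ∀ i j → P i · ((Q j ∧ adj G i j) · 1) ≡ Q j · ((P i ∧ adj G j i) · 1)
    swap i j rewrite Graph.sym G i j with P i | Q j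
    ... | true  | true  = refl
    ... | true  | false = refl
    ... | false | true  = refl
    ... | false | false = refl

  module Split (U S : Subset p) (S⊆U : S ⊆ U) where
    rest : Subset p
    rest = U − S

    out : Fin p → ℕ
    out = deg rest

    load : Fin p → ℕ
    load i = deg U i + out i

    deg-split : ∀ i → deg U i ≡ out i + deg S i
    deg-split i = trans (‖−‖ {U = U ∩N i} {S ∩N i} S∩N⊆U∩N) (cong (_+ deg S i) (sum-cong-≗ same))
      where
      S∩N⊆U∩N : (S ∩N i) ⊆ (U ∩N i)
      S∩N⊆U∩N j e = let Sj , ij = ∧-true (S j) _ e in cong₂ _∧_ (S⊆U j Sj) ij
      same : ∀ j → ((U ∩N i) − (S ∩N i)) j · 1 ≡ (rest ∩N i) j · 1
      same j with U j | S j | adj G i j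
      ... | true  | true  | true  = refl
      ... | true  | true  | false = refl
      ... | true  | false | true  = refl
      ... | true  | false | false = refl
      ... | false | _     | true  = refl
      ... | false | _     | false = refl

    ‖U‖-split : ‖ U ‖ ≡ ‖ rest ‖ + ‖ S ‖
    ‖U‖-split = ‖−‖ S⊆U

    degSum-split : degSum U ≡ degSum rest + ∑[ i < p ] (S i · load i)
    degSum-split = begin
      degSum U                                            ≡⟨ ∑-split S⊆U (deg U) ⟩
      ∑S (deg U) + ∑[ i < p ] (rest i · deg U i)          ≡⟨ cong (∑S (deg U) +_) rest-part ⟩
      ∑S (deg U) + (degSum rest + ∑S out)                 ≡⟨ x∙yz≈y∙xz (∑S (deg U)) (degSum rest) (∑S out) ⟩
      degSum rest + (∑S (deg U) + ∑S out)                 ≡⟨ cong (degSum rest +_) load-part ⟨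
      degSum rest + ∑S load                               ∎
      where
      open ≡-Reasoning
      ∑S : (Fin p → ℕ) → ℕ
      ∑S f = ∑[ i < p ] (S i · f i)
      rest-part : ∑[ i < p ] (rest i · deg U i) ≡ degSum rest + ∑S out
      rest-part = begin
        ∑[ i < p ] (rest i · deg U i)                          ≡⟨ sum-cong-≗ (λ i → trans (cong (rest i ·_) (deg-split i)) (·-distrib-+ (rest i) (out i) (deg S i))) ⟩
        ∑[ i < p ] (rest i · out i + rest i · deg S i)         ≡⟨ ∑-distrib-+ (λ i → rest i · out i) (λ i → rest i · deg S i) ⟩
        degSum rest + ∑[ i < p ] (rest i · deg S i)            ≡⟨ cong (degSum rest +_) (edges-between rest S) ⟩
        degSum rest + ∑S out                                   ∎
      load-part : ∑S load ≡ ∑S (deg U) + ∑S out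
      load-part = trans (sum-cong-≗ (λ i → ·-distrib-+ (S i) (deg U i) (out i)))
                        (∑-distrib-+ (λ i → S i · deg U i) (λ i → S i · out i))

    combine : ∀ {K₁ K₂} → degSum rest + K₁ ≤ c * ‖ rest ‖ →
      ∑[ i < p ] (S i · load i) + K₂ ≤ c * ‖ S ‖ → degSum U + (K₁ + K₂) ≤ c * ‖ U ‖
    combine {K₁} {K₂} rest-bound S-bound = begin
      degSum U + (K₁ + K₂)                  ≡⟨ cong (_+ (K₁ + K₂)) degSum-split ⟩
      degSum rest + L + (K₁ + K₂)           ≡⟨ interchange (degSum rest) L K₁ K₂ ⟩
      (degSum rest + K₁) + (L + K₂)         ≤⟨ +-mono-≤ rest-bound S-bound ⟩
      c * ‖ rest ‖ + c * ‖ S ‖              ≡⟨ *-distribˡ-+ c ‖ rest ‖ ‖ S ‖ ⟨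
      c * (‖ rest ‖ + ‖ S ‖)                ≡⟨ cong (c *_) ‖U‖-split ⟨
      c * ‖ U ‖                             ∎
      where
      open ≤-Reasoning
      L : ℕ
      L = ∑[ i < p ] (S i · load i)

  module Star (U : Subset p) (x : Fin p) (Ux : U x ≡ true) where
    N : Subset p
    N = U ∩N x

    S : Subset p
    S = insert x N

    x∉N : N x ≡ false
    x∉N rewrite irref G x = ∧-zeroʳ (U x)

    x∈S : S x ≡ true
    x∈S rewrite dec-true (x ≟ x) refl = refl

    N⊆S : N ⊆ S
    N⊆S i Ni rewrite Ni = ∨-zeroʳ (does (i ≟ x))

    S⊆U : S ⊆ U
    S⊆U i Si with i ≟ x
    ... | yes refl = Ux
    ... | no  _    = proj₁ (∩N-elim U x i Si)

    open Split U S S⊆U public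

    ‖S‖ : ‖ S ‖ ≡ suc (deg U x)
    ‖S‖ = ∑-insert x N x∉N (λ _ → 1)

    rest-smaller : ‖ rest ‖ < ‖ U ‖
    rest-smaller = subst (‖ rest ‖ <_) (sym (trans ‖U‖-split (cong (‖ rest ‖ +_) ‖S‖))) (m<m+n ‖ rest ‖ z<s)

    -- x has no neighbours outside its closed neighbourhood, so its load is its degree.
    load-x : load x ≡ deg U x
    load-x = trans (cong (deg U x +_) (‖‖-empty (rest ∩N x) none)) (+-identityʳ (deg U x))
      where
      none : ∀ j → (rest ∩N x) j ≡ false
      none j with U j | adj G x j
      ... | true  | true  rewrite ∨-zeroʳ (does (j ≟ x)) = refl
      ... | true  | false = ∧-zeroʳ _
      ... | false | _     = refl

    -- A U-neighbour y of x has the neighbour x inside S, hence load y < 2 deg_U(y).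
    load-neighbour : ∀ {y d} → N y ≡ true → deg U y ≤ d → load y + 1 ≤ 2 * d
    load-neighbour {y} {d} Ny deg≤d = begin
      deg U y + out y + 1         ≤⟨ +-monoʳ-≤ (deg U y + out y) (‖‖-pos (S ∩N y) x x∈S∩Ny) ⟩
      deg U y + out y + deg S y   ≡⟨ +-assoc (deg U y) (out y) (deg S y) ⟩
      deg U y + (out y + deg S y) ≡⟨ cong (deg U y +_) (deg-split y) ⟨
      deg U y + deg U y           ≤⟨ +-mono-≤ deg≤d (≤-trans deg≤d (m≤m+n d 0)) ⟩
      d + (d + 0)                 ∎
      where
      open ≤-Reasoning
      x∈S∩Ny : (S ∩N y) x ≡ true
      x∈S∩Ny = cong₂ _∧_ x∈S (adj-sym (proj₂ (∩N-elim U x y Ny)))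

    star-load : ∀ B → (∀ y → N y ≡ true → load y ≤ B) → ∑[ i < p ] (S i · load i) ≤ deg U x + B * deg U x
    star-load B bounded = begin
      ∑[ i < p ] (S i · load i)          ≡⟨ ∑-insert x N x∉N load ⟩
      load x + ∑[ i < p ] (N i · load i) ≤⟨ +-mono-≤ (≤-reflexive load-x) (∑-bound N load B bounded) ⟩
      deg U x + B * deg U x              ∎
      where open ≤-Reasoning

    x~ : ∀ {y} → N y ≡ true → adj G x y ≡ true
    x~ {y} Ny = proj₂ (∩N-elim U x y Ny)

    -- If deg_U(x) > c then every U-neighbour y of x has degree at most 2:
    -- two neighbours a, b of y besides x would force deg(x) ≤ c.
    light-neighbours : suc c ≤ deg U x → ∀ {y} → N y ≡ true → deg U y ≤ 2
    light-neighbours big {y} Ny with deg U y ≤? 2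
    ... | yes light = light
    ... | no  heavy with choose-two ((U ∩N y) ∖ x) (‖∖‖-lower (U ∩N y) x (≰⇒> heavy))
    ... | a , b , a≢b , a∈ , b∈ =
      let a∈U∩N , a≢x = ∖-elim (U ∩N y) a∈
          b∈U∩N , b≢x = ∖-elim (U ∩N y) b∈
          ya = proj₂ (∩N-elim U y a a∈U∩N)
          yb = proj₂ (∩N-elim U y b b∈U∩N)
      in ⊥-elim (<-irrefl refl (≤-trans big (≤-trans (deg≤ U x) (degree-bound (x~ Ny) ya yb a≢b a≢x b≢x))))

    -- For k = 0, a U-neighbour y of x has no neighbour z ≠ x besides two
    -- further U-neighbours a, b of x: z would be a private neighbour of y
    -- in the tree with root y and centre x.
    no-private₀ : k ≡ 0 → ∀ {y z} → N y ≡ true → adj G y z ≡ true → z ≢ x → 2 ≤ ‖ N ∖ y ∖ z ‖ → ⊥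
    no-private₀ k≡0 {y} {z} Ny yz z≢x two with choose-two (N ∖ y ∖ z) two
    ... | a , b , a≢b , a∈ , b∈ =
      let a∈N∖y , a≢z = ∖-elim (N ∖ y) a∈
          a∈N   , a≢y = ∖-elim N a∈N∖y
          b∈N∖y , b≢z = ∖-elim (N ∖ y) b∈
          b∈N   , b≢y = ∖-elim N b∈N∖y
          z-private : (adj G y ∖ x ∖ a ∖ b) z ≡ true
          z-private = ∖-intro (adj G y ∖ x ∖ a) (∖-intro (adj G y ∖ x) (∖-intro (adj G y) yz z≢x) (a≢z ∘ sym)) (b≢z ∘ sym)
          few = few-private-neighbours free (adj-sym (x~ Ny)) (x~ a∈N) (x~ b∈N) a≢b a≢y b≢y
      in n≮0 (≤-trans (‖‖-pos (adj G y ∖ x ∖ a ∖ b) z z-private) (subst (‖ adj G y ∖ x ∖ a ∖ b ‖ ≤_) k≡0 few))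

    light-neighbours₀ : k ≡ 0 → suc c ≤ deg U x → ∀ {y} → N y ≡ true → deg U y ≤ 1
    light-neighbours₀ k≡0 big {y} Ny with deg U y ≤? 1
    ... | yes light = light
    ... | no  heavy with choose-one ((U ∩N y) ∖ x) (‖∖‖-lower (U ∩N y) x (≰⇒> heavy))
    ... | z , z∈ =
      let z∈U∩N , z≢x = ∖-elim (U ∩N y) z∈
      in ⊥-elim (no-private₀ k≡0 Ny (proj₂ (∩N-elim U y z z∈U∩N)) z≢x
           (‖∖‖-lower (N ∖ y) z (‖∖‖-lower N y (≤-trans (m≤m+n 4 k) big))))

    outside-S : ∀ z v → S z ≡ false → S v ≡ true → z ≢ v
    outside-S z v Sz Sv refl = true≢false (trans (sym Sv) Sz)

    no-exit₀ : k ≡ 0 → c ≤ deg U x → ∀ {y z} → N y ≡ true → adj G y z ≡ true → S z ≡ false → ⊥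
    no-exit₀ k≡0 big {y} {z} Ny yz Sz =
      no-private₀ k≡0 Ny yz (outside-S z x Sz x∈S)
        (subst (2 ≤_) (sym (‖∖‖-∉ (N ∖ y) z z∉N∖y)) (‖∖‖-lower N y (≤-trans (m≤m+n 3 k) big)))
      where
      z∉N∖y : (N ∖ y) z ≡ false
      z∉N∖y = cong (_∧ not (does (z ≟ y))) (∨-false (does (z ≟ x)) (N z) Sz)

    -- If deg_U(x) ≥ c, a U-neighbour w of x of degree at least 3 has all its
    -- U-neighbours in S: a neighbour j ∉ S of w would leave x with at most
    -- k + 2 neighbours.
    heavy-closed : c ≤ deg U x → ∀ {w} → N w ≡ true → 3 ≤ deg U w → (U ∩N w) ⊆ S
    heavy-closed big {w} Nw heavy j j∈ with j ≟ x
    ... | yes refl = refl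
    ... | no  j≢x with adj G x j in xj
    ...   | true  = cong (_∧ true) (proj₁ (∩N-elim U w j j∈))
    ...   | false with choose-one ((U ∩N w) ∖ x ∖ j) (‖∖‖-lower ((U ∩N w) ∖ x) j (‖∖‖-lower (U ∩N w) x heavy))
    ...     | b , b∈ = ⊥-elim (<-irrefl refl (≤-trans big small))
      where
      open ≤-Reasoning
      b-facts : ((U ∩N w) b ≡ true × b ≢ x) × b ≢ j
      b-facts = let b∈′ , b≢j = ∖-elim ((U ∩N w) ∖ x) b∈ in ∖-elim (U ∩N w) b∈′ , b≢j
      few : ‖ adj G x ∖ w ∖ j ∖ b ‖ ≤ k
      few = few-private-neighbours free (x~ Nw) (proj₂ (∩N-elim U w j j∈))
              (proj₂ (∩N-elim U w b (proj₁ (proj₁ b-facts)))) (proj₂ b-facts ∘ sym) j≢x (proj₂ (proj₁ b-facts))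
      small : deg U x ≤ 2 + k
      small = begin
        deg U x                         ≤⟨ deg≤ U x ⟩
        ‖ adj G x ‖                     ≤⟨ ‖∖‖-≤ (adj G x) w ⟩
        ‖ adj G x ∖ w ‖ + 1             ≡⟨ cong (_+ 1) (‖∖‖-∉ (adj G x ∖ w) j (cong (_∧ not (does (j ≟ w))) xj)) ⟨
        ‖ adj G x ∖ w ∖ j ‖ + 1         ≤⟨ +-monoˡ-≤ 1 (‖∖‖-≤ (adj G x ∖ w ∖ j) b) ⟩
        ‖ adj G x ∖ w ∖ j ∖ b ‖ + 1 + 1 ≤⟨ +-monoˡ-≤ 1 (+-monoˡ-≤ 1 few) ⟩
        k + 1 + 1                       ≡⟨ +-assoc k 1 1 ⟩
        k + 2                           ≡⟨ +-comm k 2 ⟩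
        2 + k                           ∎

    bounded-by-loads : ∀ {B} → B < c → (∀ y → N y ≡ true → load y ≤ B) → Bounded rest → Bounded U
    bounded-by-loads {B} B<c loads (rest-bound , _) =
      Bounded-strong (combine {0} {c} (subst (_≤ c * ‖ rest ‖) (sym (+-identityʳ (degSum rest))) rest-bound) S-bound)
      where
      open ≤-Reasoning
      S-bound : ∑[ i < p ] (S i · load i) + c ≤ c * ‖ S ‖
      S-bound = begin
        ∑[ i < p ] (S i · load i) + c ≤⟨ +-monoˡ-≤ c (star-load B loads) ⟩
        deg U x + B * deg U x + c     ≤⟨ star-arith (deg U x) B<c ⟩
        c * suc (deg U x)             ≡⟨ cong (c *_) ‖S‖ ⟨
        c * ‖ S ‖                     ∎

    -- Case deg_U(x) > c: the neighbours of x are light.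
    high-degree : suc c ≤ deg U x → Bounded rest → Bounded U
    high-degree big with 1 ≤? k
    ... | yes k≥1 = bounded-by-loads (+-monoʳ-≤ 3 k≥1)
          (λ y Ny → +-cancelʳ-≤ 1 (load y) 3 (load-neighbour Ny (light-neighbours big Ny)))
    ... | no  k≱1 = bounded-by-loads (s≤s (s≤s z≤n))
          (λ y Ny → +-cancelʳ-≤ 1 (load y) 1 (load-neighbour Ny (light-neighbours₀ (n<1⇒n≡0 (≰⇒> k≱1)) big Ny)))

    module Exit (deg-x : deg U x ≡ c) (y₀ z : Fin p) (Ny₀ : N y₀ ≡ true)
                (z∈rest : rest z ≡ true) (y₀z : adj G y₀ z ≡ true) where
      c≤deg : c ≤ deg U x
      c≤deg = ≤-reflexive (sym deg-x)

      z∉S : S z ≡ false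
      z∉S = not-true (S z) (proj₂ (∧-true (U z) _ z∈rest))

      out-y₀ : 1 ≤ out y₀
      out-y₀ = ‖‖-pos (rest ∩N y₀) z (cong₂ _∧_ z∈rest y₀z)

      -- A heavy U-neighbour w of x (degree ≥ 3) has all its U-neighbours in
      -- S ∖ {w, y₀}, hence degree at most c − 1 and no neighbour outside S.
      module Heavy {w : Fin p} (Nw : N w ≡ true) (heavy : 3 ≤ deg U w) where
        out-w : out w ≡ 0
        out-w = ‖‖-empty (rest ∩N w) none
          where
          none : ∀ j → (rest ∩N w) j ≡ false
          none j with (rest ∩N w) j in e
          ... | false = refl
          ... | true  = let j∈rest , wj = ∩N-elim rest w j e
                            Uj , j∉S    = ∧-true (U j) _ j∈rest
                        in ⊥-elim (true≢false (trans (sym (heavy-closed c≤deg Nw heavy j (cong₂ _∧_ Uj wj)))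
                                                     (not-true (S j) j∉S)))

        w≢y₀ : w ≢ y₀
        w≢y₀ refl = n≮0 (subst (0 <_) out-w out-y₀)

        w≁y₀ : adj G w y₀ ≡ false
        w≁y₀ with adj G w y₀ in wy₀
        ... | false = refl
        ... | true  = ⊥-elim (true≢false (trans (sym (heavy-closed c≤deg Ny₀ heavy-y₀ z z∈U∩Ny₀)) z∉S))
          where
          z∈U∩Ny₀ : (U ∩N y₀) z ≡ true
          z∈U∩Ny₀ = cong₂ _∧_ (proj₁ (∧-true (U z) _ z∈rest)) y₀z
          heavy-y₀ : 3 ≤ deg U y₀
          heavy-y₀ = ‖‖-three (U ∩N y₀) (cong₂ _∧_ Ux (adj-sym (x~ Ny₀)))
                       (cong₂ _∧_ (S⊆U w (N⊆S w Nw)) (adj-sym wy₀)) z∈U∩Ny₀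
                       (adj⇒≢ (x~ Nw)) (outside-S z x z∉S x∈S ∘ sym) (outside-S z w z∉S (N⊆S w Nw) ∘ sym)

        deg-w : deg U w ≤ 2 + k
        deg-w = +-cancelʳ-≤ 2 (deg U w) (2 + k) (begin
          deg U w + 2              ≤⟨ +-monoˡ-≤ 2 (‖‖-mono inside) ⟩
          ‖ S ∖ w ∖ y₀ ‖ + 2       ≡⟨ +-assoc ‖ S ∖ w ∖ y₀ ‖ 1 1 ⟨
          ‖ S ∖ w ∖ y₀ ‖ + 1 + 1   ≡⟨ cong (_+ 1) (‖∖‖-∈ (S ∖ w) y₀ (∖-intro S (N⊆S y₀ Ny₀) (w≢y₀ ∘ sym))) ⟨
          ‖ S ∖ w ‖ + 1            ≡⟨ ‖∖‖-∈ S w (N⊆S w Nw) ⟨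
          ‖ S ‖                    ≡⟨ trans ‖S‖ (cong suc deg-x) ⟩
          4 + k                    ≡⟨ +-comm 2 (2 + k) ⟩
          2 + k + 2                ∎)
          where
          open ≤-Reasoning
          inside : (U ∩N w) ⊆ (S ∖ w ∖ y₀)
          inside j j∈ = let wj = proj₂ (∩N-elim U w j j∈) in
            ∖-intro (S ∖ w) {y₀} {j} (∖-intro S {w} {j} (heavy-closed c≤deg Nw heavy j j∈) (adj⇒≢ wj ∘ sym))
              (λ { refl → true≢false (trans (sym wj) w≁y₀) })

      exit-loads : 1 ≤ k → ∀ w → N w ≡ true → load w ≤ 2 + k
      exit-loads k≥1 w Nw with deg U w ≤? 2
      ... | yes light = ≤-trans (+-cancelʳ-≤ 1 (load w) 3 (load-neighbour Nw light)) (+-monoʳ-≤ 2 k≥1)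
      ... | no  heavy = subst (_≤ 2 + k) (sym (trans (cong (deg U w +_) (Heavy.out-w Nw (≰⇒> heavy))) (+-identityʳ (deg U w))))
                          (Heavy.deg-w Nw (≰⇒> heavy))

      exit-bounded : Bounded rest → Bounded U
      exit-bounded with 1 ≤? k
      ... | yes k≥1 = bounded-by-loads (n<1+n (2 + k)) (exit-loads k≥1)
      ... | no  k≱1 = ⊥-elim (no-exit₀ (n<1⇒n≡0 (≰⇒> k≱1)) c≤deg Ny₀ y₀z z∉S)

    -- Case deg_U(x) = c is the maximum degree and no U-neighbour of x has a
    -- neighbour outside S: then S has c + 1 vertices and carries at most c ‖S‖.
    closed-bounded : deg U x ≡ c → (∀ i → U i ≡ true → deg U i ≤ c) →
      (∀ y → N y ≡ true → out y ≡ 0) → Bounded rest → Bounded U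
    closed-bounded deg-x max no-out (rest-bound , rest-strong) = weak , strong
      where
      ‖S‖≡ : ‖ S ‖ ≡ suc c
      ‖S‖≡ = trans ‖S‖ (cong suc deg-x)
      loads : ∀ y → N y ≡ true → load y ≤ c
      loads y Ny = subst (_≤ c) (sym (trans (cong (deg U y +_) (no-out y Ny)) (+-identityʳ (deg U y))))
                     (max y (proj₁ (∩N-elim U x y Ny)))
      S-bound : ∑[ i < p ] (S i · load i) + 0 ≤ c * ‖ S ‖
      S-bound = begin
        ∑[ i < p ] (S i · load i) + 0 ≡⟨ +-identityʳ _ ⟩
        ∑[ i < p ] (S i · load i)     ≤⟨ star-load c loads ⟩
        deg U x + c * deg U x         ≤⟨ closed-arith (max x Ux) ⟩
        c * suc (deg U x)             ≡⟨ cong (c *_) ‖S‖ ⟨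
        c * ‖ S ‖                     ∎
        where open ≤-Reasoning
      weak : degSum U ≤ c * ‖ U ‖
      weak = subst (_≤ c * ‖ U ‖) (+-identityʳ (degSum U))
               (combine {0} {0} (subst (_≤ c * ‖ rest ‖) (sym (+-identityʳ (degSum rest))) rest-bound) S-bound)
      strong : ¬ (suc c ∣ ‖ U ‖) → degSum U + c ≤ c * ‖ U ‖
      strong ndiv = subst (λ K → degSum U + K ≤ c * ‖ U ‖) (+-identityʳ c) (combine {c} {0} (rest-strong ndiv-rest) S-bound)
        where
        ndiv-rest : ¬ (suc c ∣ ‖ rest ‖)
        ndiv-rest d = ndiv (subst (suc c ∣_) (sym ‖U‖-split) (∣m∣n⇒∣m+n d (subst (suc c ∣_) (sym ‖S‖≡) ∣-refl)))

    top-degree : deg U x ≡ c → (∀ i → U i ≡ true → deg U i ≤ c) → Bounded rest → Bounded U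
    top-degree deg-x max with any? (λ y → (N y ≟ᴮ true) ×-dec (1 ≤? out y))
    ... | yes (y₀ , Ny₀ , exits) =
      let z , z∈ = choose-one (rest ∩N y₀) exits
          z∈rest , y₀z = ∩N-elim rest y₀ z z∈
      in Exit.exit-bounded deg-x y₀ z Ny₀ z∈rest y₀z
    ... | no  none = closed-bounded deg-x max (λ y Ny → n<1⇒n≡0 (≰⇒> (λ exits → none (y , Ny , exits))))

  deg<‖U‖ : ∀ U i → U i ≡ true → suc (deg U i) ≤ ‖ U ‖
  deg<‖U‖ U i Ui = subst (suc (deg U i) ≤_) (sym (trans (‖∖‖-∈ U i Ui) (+-comm ‖ U ∖ i ‖ 1)))
    (s≤s (‖‖-mono (λ j e → let Uj , ij = ∩N-elim U i j e in ∖-intro U Uj (adj⇒≢ ij ∘ sym))))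

  low-degree : ∀ U → (∀ i → U i ≡ true → deg U i ≤ 2 + k) → Bounded U
  low-degree U low = ≤-trans (sum-bound low) (*-monoˡ-≤ ‖ U ‖ (n≤1+n (2 + k))) , strong
    where
    open ≤-Reasoning
    sum-bound : ∀ {B} → (∀ i → U i ≡ true → deg U i ≤ B) → degSum U ≤ B * ‖ U ‖
    sum-bound {B} = ∑-bound U (deg U) B
    small-set : ∀ m → ‖ U ‖ ≡ m → m < c → ¬ (suc c ∣ m) → degSum U + c ≤ c * m
    small-set zero    _  _   ndiv = ⊥-elim (ndiv (suc c ∣0))
    small-set (suc s) ‖U‖≡ m<c _ = begin
      degSum U + c  ≤⟨ +-monoˡ-≤ c (sum-bound (λ i Ui → ≤-pred (subst (suc (deg U i) ≤_) ‖U‖≡ (deg<‖U‖ U i Ui)))) ⟩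
      s * ‖ U ‖ + c ≡⟨ cong (λ m → s * m + c) ‖U‖≡ ⟩
      s * suc s + c ≤⟨ small-arith (<⇒≤ m<c) ⟩
      c * suc s     ∎
    strong : ¬ (suc c ∣ ‖ U ‖) → degSum U + c ≤ c * ‖ U ‖
    strong ndiv with c ≤? ‖ U ‖
    ... | yes c≤‖U‖ = begin
      degSum U + c              ≤⟨ +-mono-≤ (sum-bound low) c≤‖U‖ ⟩
      (2 + k) * ‖ U ‖ + ‖ U ‖   ≡⟨ +-comm ((2 + k) * ‖ U ‖) ‖ U ‖ ⟩
      c * ‖ U ‖                 ∎
    ... | no  c≰‖U‖ = small-set ‖ U ‖ refl (≰⇒> c≰‖U‖) ndiv

  step : ∀ U → (∀ V → ‖ V ‖ < ‖ U ‖ → Bounded V) → Bounded U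
  step U IH with any? (λ i → (U i ≟ᴮ true) ×-dec (suc c ≤? deg U i))
  ... | yes (x , Ux , big) = Star.high-degree U x Ux big (IH (Star.rest U x Ux) (Star.rest-smaller U x Ux))
  ... | no  no-big with any? (λ i → (U i ≟ᴮ true) ×-dec (c ≤? deg U i))
  ...   | yes (x , Ux , c≤) =
    let max : ∀ i → U i ≡ true → deg U i ≤ c
        max i Ui = ≤-pred (≰⇒> (λ big → no-big (i , Ui , big)))
    in Star.top-degree U x Ux (≤-antisym (max x Ux) c≤) max (IH (Star.rest U x Ux) (Star.rest-smaller U x Ux))
  ...   | no  no-c = low-degree U (λ i Ui → ≤-pred (≰⇒> (λ c≤ → no-c (i , Ui , c≤))))

  bounded : ∀ U → Bounded U
  bounded U = below (suc ‖ U ‖) U ≤-refl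
    where
    below : ∀ m V → ‖ V ‖ < m → Bounded V
    below (suc m) V (s≤s ‖V‖≤m) = step V (λ W W<V → below m W (≤-trans W<V ‖V‖≤m))

  upper-bound : ¬ (suc c ∣ p) → 2 * edgeCount G + c ≤ c * p
  upper-bound ndiv = subst₂ (λ E m → E + c ≤ c * m) (sym (handshake G)) (‖‖-full p)
    (proj₂ (bounded (λ _ → true)) (ndiv ∘ subst (suc c ∣_) (‖‖-full p)))

Σ< : ℕ → (ℕ → ℕ) → ℕ
Σ< p f = ∑[ i < p ] f (toℕ i)

Σ<-last : ∀ p f → Σ< (suc p) f ≡ Σ< p f + f p
Σ<-last p f = trans (sum-init-last {p} (λ i → f (toℕ i)))
  (cong₂ _+_ (sum-cong-≗ {p} (λ i → cong f (toℕ-inject₁ i))) (cong f (toℕ-fromℕ p)))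

Σ<-cong : ∀ p {f g : ℕ → ℕ} → (∀ b → b < p → f b ≡ g b) → Σ< p f ≡ Σ< p g
Σ<-cong p eq = sum-cong-≗ (λ i → eq (toℕ i) (toℕ<n i))

two-products : ∀ a b → 2 * a * b ≤ a * a + b * b
two-products a b with ≤-total a b
... | inj₁ a≤b = subst (λ b → 2 * a * b ≤ a * a + b * b) (m+[n∸m]≡n a≤b)
                   (≤-trans (m≤m+n _ _) (≤-reflexive (square a (b ∸ a))))
  where
  square : ∀ a d → 2 * a * (a + d) + d * d ≡ a * a + (a + d) * (a + d)
  square = solve-∀
... | inj₂ b≤a = subst (λ a → 2 * a * b ≤ a * a + b * b) (m+[n∸m]≡n b≤a)
                   (≤-trans (m≤m+n _ _) (≤-reflexive (square b (a ∸ b))))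
  where
  square : ∀ b d → 2 * (b + d) * b + d * d ≡ (b + d) * (b + d) + b * b
  square = solve-∀

module Blocks (c : ℕ) where
  m : ℕ
  m = suc c

  sameBlock : ℕ → ℕ → Bool
  sameBlock a b = not (a ≡ᵇ b) ∧ (a / m ≡ᵇ b / m)

  sameBlock-sym : ∀ a b → sameBlock a b ≡ sameBlock b a
  sameBlock-sym a b rewrite ≡ᵇ-comm a b | ≡ᵇ-comm (a / m) (b / m) = refl

  sameBlock-irrefl : ∀ a → sameBlock a a ≡ false
  sameBlock-irrefl a rewrite ≡ᵇ-refl a = refl

  blockGraph : ∀ p → Graph p
  blockGraph p = record
    { adj   = λ i j → sameBlock (toℕ i) (toℕ j)
    ; sym   = λ i j → sameBlock-sym (toℕ i) (toℕ j)
    ; irref = λ i → sameBlock-irrefl (toℕ i)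
    }

  -- A copy in blockGraph p of a connected graph lies inside one block, so
  -- a connected graph on more than m vertices has no copy.
  blockGraph-free : ∀ {q} p (L : Graph (suc q)) → m < suc q → Connected L → ¬ ContainsSubgraph (blockGraph p) L
  blockGraph-free {q} p L m<q connected (f , f-inj , f-edges) = <⇒≢ i<j (cong toℕ (f-inj fi≡fj))
    where
    block : Fin (suc q) → ℕ
    block v = toℕ (f v) / m
    one-block : ∀ v → block v ≡ block zero
    one-block = connected block (λ u v e →
      ≡ᵇ-sound _ _ (proj₂ (∧-true (not (toℕ (f u) ≡ᵇ toℕ (f v))) _ (f-edges u v e))))
    residue : Fin (suc q) → Fin m
    residue v = fromℕ< (m%n<n (toℕ (f v)) m)
    collision : Σ (Fin (suc q)) λ i → Σ (Fin (suc q)) λ j → toℕ i < toℕ j × residue i ≡ residue j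
    collision = pigeonhole m<q residue
    i j : Fin (suc q)
    i = proj₁ collision
    j = proj₁ (proj₂ collision)
    i<j : toℕ i < toℕ j
    i<j = proj₁ (proj₂ (proj₂ collision))
    same-residue : toℕ (f i) % m ≡ toℕ (f j) % m
    same-residue = trans (sym (toℕ-fromℕ< (m%n<n (toℕ (f i)) m)))
      (trans (cong toℕ (proj₂ (proj₂ (proj₂ collision)))) (toℕ-fromℕ< (m%n<n (toℕ (f j)) m)))
    fi≡fj : f i ≡ f j
    fi≡fj = toℕ-injective (begin
      toℕ (f i)                     ≡⟨ m≡m%n+[m/n]*n (toℕ (f i)) m ⟩
      toℕ (f i) % m + block i * m   ≡⟨ cong₂ (λ r q → r + q * m) same-residue (trans (one-block i) (sym (one-block j))) ⟩
      toℕ (f j) % m + block j * m   ≡⟨ m≡m%n+[m/n]*n (toℕ (f j)) m ⟨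
      toℕ (f j)                     ∎)
      where open ≡-Reasoning

  div-step : ∀ L → (suc L % m ≡ suc (L % m) × suc L / m ≡ L / m)
                 ⊎ (L % m ≡ c × suc L % m ≡ 0 × suc L / m ≡ suc (L / m))
  div-step L with suc (L % m) <? m
  ... | yes r+1<m = inj₁ (residue , quotient)
    where
    split : suc L ≡ suc (L % m) + (L / m) * m
    split = cong suc (m≡m%n+[m/n]*n L m)
    residue : suc L % m ≡ suc (L % m)
    residue = trans (cong (_% m) split) (trans ([m+kn]%n≡m%n (suc (L % m)) (L / m) m) (m<n⇒m%n≡m r+1<m))
    quotient : suc L / m ≡ L / m
    quotient = trans (cong (_/ m) split) (trans (+-distrib-/ (suc (L % m)) ((L / m) * m) fits)
                 (cong₂ _+_ (m<n⇒m/n≡0 r+1<m) (m*n/n≡m (L / m) m)))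
      where
      fits : suc (L % m) % m + (L / m) * m % m < m
      fits = subst₂ (λ r s → r + s < m) (sym (m<n⇒m%n≡m r+1<m)) (sym (m*n%n≡0 (L / m) m))
               (subst (_< m) (sym (+-identityʳ _)) r+1<m)
  ... | no  r+1≮m = inj₂ (last , residue , quotient)
    where
    full : suc (L % m) ≡ m
    full = ≤-antisym (m%n<n L m) (≮⇒≥ r+1≮m)
    last : L % m ≡ c
    last = suc-injective full
    split : suc L ≡ suc (L / m) * m
    split = trans (cong suc (m≡m%n+[m/n]*n L m)) (cong (_+ (L / m) * m) full)
    residue : suc L % m ≡ 0
    residue = trans (cong (_% m) split) (m*n%n≡0 (suc (L / m)) m)
    quotient : suc L / m ≡ suc (L / m)
    quotient = trans (cong (_/ m) split) (m*n/n≡m (suc (L / m)) m)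

  inBlock : ℕ → ℕ → ℕ
  inBlock L q = Σ< L (λ b → (q ≡ᵇ b / m) · 1)

  inBlock-later : ∀ L q → L / m < q → inBlock L q ≡ 0
  inBlock-later L q later = trans (Σ<-cong L none) (sum-replicate-zero L)
    where
    none : ∀ b → b < L → (q ≡ᵇ b / m) · 1 ≡ 0
    none b b<L rewrite ≡ᵇ-false q (b / m) (λ e → <-irrefl (sym e) (≤-<-trans (/-monoˡ-≤ m (<⇒≤ b<L)) later)) = refl

  inBlock-own : ∀ L → inBlock L (L / m) ≡ L % m
  inBlock-own zero = refl
  inBlock-own (suc L) with div-step L
  ... | inj₁ (residue , quotient) = begin
    inBlock (suc L) (suc L / m)               ≡⟨ cong (inBlock (suc L)) quotient ⟩
    inBlock (suc L) (L / m)                   ≡⟨ Σ<-last L (λ b → (L / m ≡ᵇ b / m) · 1) ⟩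
    inBlock L (L / m) + (L / m ≡ᵇ L / m) · 1  ≡⟨ cong₂ _+_ (inBlock-own L) (cong (_· 1) (≡ᵇ-refl (L / m))) ⟩
    L % m + 1                                 ≡⟨ +-comm (L % m) 1 ⟩
    suc (L % m)                               ≡⟨ residue ⟨
    suc L % m                                 ∎
    where open ≡-Reasoning
  ... | inj₂ (_ , residue , quotient) = begin
    inBlock (suc L) (suc L / m)                           ≡⟨ cong (inBlock (suc L)) quotient ⟩
    inBlock (suc L) (suc (L / m))                         ≡⟨ Σ<-last L (λ b → (suc (L / m) ≡ᵇ b / m) · 1) ⟩
    inBlock L (suc (L / m)) + (suc (L / m) ≡ᵇ L / m) · 1  ≡⟨ cong₂ _+_ (inBlock-later L (suc (L / m)) ≤-refl)
                                                               (cong (_· 1) (≡ᵇ-false (suc (L / m)) (L / m) 1+n≢n)) ⟩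
    0                                                     ≡⟨ residue ⟨
    suc L % m                                             ∎
    where open ≡-Reasoning

  Q : ℕ → ℕ
  Q p = Σ< p (λ a → Σ< p (λ b → sameBlock a b · 1))

  Q-edges : ∀ p → 2 * edgeCount (blockGraph p) ≡ Q p
  Q-edges p = handshake (blockGraph p)

  -- Adding the vertex p creates p % m edges, each counted twice.
  Q-step : ∀ p → Q (suc p) ≡ Q p + 2 * (p % m)
  Q-step p = begin
    Q (suc p)
      ≡⟨ Σ<-last p (λ a → Σ< (suc p) (A a)) ⟩
    Σ< p (λ a → Σ< (suc p) (A a)) + Σ< (suc p) (A p)
      ≡⟨ cong₂ _+_ (trans (Σ<-cong p (λ a _ → Σ<-last p (A a))) (∑-distrib-+ {p} (λ i → Σ< p (A (toℕ i))) (λ i → A (toℕ i) p))) (Σ<-last p (A p)) ⟩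
    (Q p + Σ< p (λ a → A a p)) + (Σ< p (A p) + A p p)
      ≡⟨ cong₂ (λ u v → (Q p + u) + (Σ< p (A p) + v)) (Σ<-cong p (λ a _ → sameBlock-sym′ a p)) (cong (_· 1) (sameBlock-irrefl p)) ⟩
    (Q p + Σ< p (A p)) + (Σ< p (A p) + 0)
      ≡⟨ cong (λ u → (Q p + u) + (u + 0)) own-block ⟩
    (Q p + p % m) + (p % m + 0)
      ≡⟨ regroup (Q p) (p % m) ⟩
    Q p + 2 * (p % m) ∎
    where
    open ≡-Reasoning
    A : ℕ → ℕ → ℕ
    A a b = sameBlock a b · 1
    sameBlock-sym′ : ∀ a b → A a b ≡ A b a
    sameBlock-sym′ a b = cong (_· 1) (sameBlock-sym a b)
    own-block : Σ< p (A p) ≡ p % m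
    own-block = trans (Σ<-cong p earlier) (inBlock-own p)
      where
      earlier : ∀ b → b < p → A p b ≡ (p / m ≡ᵇ b / m) · 1
      earlier b b<p rewrite ≡ᵇ-false p b (λ e → <-irrefl (sym e) b<p) = refl
    regroup : ∀ x r → (x + r) + (r + 0) ≡ x + 2 * r
    regroup = solve-∀

  Q-closed : ∀ p → Q p + m * (p % m) ≡ c * p + (p % m) * (p % m)
  Q-closed zero = trans (*-zeroʳ m) (sym (trans (+-identityʳ (c * 0)) (*-zeroʳ c)))
  Q-closed (suc p) with div-step p
  ... | inj₁ (residue , _) rewrite residue | Q-step p =
    trans (grow c (Q p) (p % m)) (trans (cong (_+ (2 * (p % m) + m)) (Q-closed p)) (sym (grown c p (p % m))))
    where
    grow : ∀ d x r → x + 2 * r + suc d * suc r ≡ (x + suc d * r) + (2 * r + suc d)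
    grow = solve-∀
    grown : ∀ d p r → d * suc p + suc r * suc r ≡ (d * p + r * r) + (2 * r + suc d)
    grown = solve-∀
  ... | inj₂ (last , residue , _) rewrite residue | Q-step p | last =
    trans (close c (Q p)) (trans (cong (_+ c) closed) (sym (closed-at c p)))
    where
    close : ∀ d x → x + 2 * d + suc d * 0 ≡ (x + d) + d
    close = solve-∀
    closed-at : ∀ d p → d * suc p + 0 * 0 ≡ d * p + d
    closed-at = solve-∀
    unfold : ∀ d x → x + suc d * d ≡ (x + d) + d * d
    unfold = solve-∀
    closed : Q p + c ≡ c * p
    closed = +-cancelʳ-≡ (c * c) (Q p + c) (c * p)
      (trans (sym (unfold c (Q p))) (subst (λ r → Q p + m * r ≡ c * p + r * r) last (Q-closed p)))

  -- Hence 4 c p ≤ 4 Q p + m², since 4 m r ≤ m² + 4 r².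
  Q-lower : ∀ p → 4 * c * p ≤ 4 * Q p + m * m
  Q-lower p = +-cancelʳ-≤ (4 * (r * r)) (4 * c * p) (4 * Q p + m * m) (begin
    4 * c * p + 4 * (r * r)             ≡⟨ expand c p r ⟨
    4 * (c * p + r * r)                 ≡⟨ cong (4 *_) (Q-closed p) ⟨
    4 * (Q p + m * r)                   ≡⟨ regroup c (Q p) r ⟩
    4 * Q p + 2 * m * (2 * r)           ≤⟨ +-monoʳ-≤ (4 * Q p) (two-products m (2 * r)) ⟩
    4 * Q p + (m * m + 2 * r * (2 * r)) ≡⟨ square c (Q p) r ⟩
    4 * Q p + m * m + 4 * (r * r)       ∎)
    where
    open ≤-Reasoning
    r : ℕ
    r = p % m
    expand : ∀ d p r → 4 * (d * p + r * r) ≡ 4 * d * p + 4 * (r * r)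
    expand = solve-∀
    regroup : ∀ d x r → 4 * (x + suc d * r) ≡ 4 * x + 2 * suc d * (2 * r)
    regroup = solve-∀
    square : ∀ d x r → 4 * x + (suc d * suc d + 2 * r * (2 * r)) ≡ 4 * x + suc d * suc d + 4 * (r * r)
    square = solve-∀

  blockGraph-edges : ∀ p → 4 * c * p ≤ 8 * edgeCount (blockGraph p) + m * m
  blockGraph-edges p = begin
    4 * c * p                                ≤⟨ Q-lower p ⟩
    4 * Q p + m * m                          ≡⟨ cong (λ q → 4 * q + m * m) (Q-edges p) ⟨
    4 * (2 * edgeCount (blockGraph p)) + m * m ≡⟨ cong (_+ m * m) (*-assoc 4 2 (edgeCount (blockGraph p))) ⟨
    8 * edgeCount (blockGraph p) + m * m     ∎
    where open ≤-Reasoning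

corollary3p1 : ∀ (p n : ℕ) → 5 ≤ n → n ≤ p → ¬ ((n ∸ 1) ∣ p) →
    ∀ (m : ℕ) → IsEx p (T2 n) m →
    (4 * (n ∸ 2) * p ≤ 8 * m + (n ∸ 1) * (n ∸ 1)) × (2 * m ≤ (n ∸ 2) * (p ∸ 1))
corollary3p1 p (suc (suc (suc (suc (suc k))))) (s≤s (s≤s (s≤s (s≤s (s≤s _))))) _ n-1∤p m ((G , G-free , edges≡m) , maximal) = lower , upper
  where
  open Blocks (3 + k) using (blockGraph; blockGraph-free; blockGraph-edges)
  open UpperBound k G G-free using (upper-bound)
  lower : 4 * (3 + k) * p ≤ 8 * m + (4 + k) * (4 + k)
  lower = ≤-trans (blockGraph-edges p) (+-monoˡ-≤ ((4 + k) * (4 + k)) (*-monoʳ-≤ 8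
            (maximal (blockGraph p) (blockGraph-free p (T2 (5 + k)) ≤-refl (Tree.T-connected k)))))
  upper : 2 * m ≤ (3 + k) * (p ∸ 1)
  upper = begin
    2 * m                   ≡⟨ cong (2 *_) edges≡m ⟨
    2 * edgeCount G         ≤⟨ m+n≤o⇒m≤o∸n (2 * edgeCount G) (upper-bound n-1∤p) ⟩
    (3 + k) * p ∸ (3 + k)   ≡⟨ cong ((3 + k) * p ∸_) (*-identityʳ (3 + k)) ⟨
    (3 + k) * p ∸ (3 + k) * 1 ≡⟨ *-distribˡ-∸ (3 + k) p 1 ⟨
    (3 + k) * (p ∸ 1)       ∎
    where open ≤-Reasoning
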